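{- Let $G$ be a column continuous subgrid of $P_n\times P_n$ and $M$ a perfect matching of $G$ which contains no $(i,j,k)$-bracket (for any $i,j,k$). Then $M$ contains no $(i,j,k)$-skew bracket of type I and no $(i,j,k)$-skew bracket of type II (for any $i,j$ and any $k>0$).
   Context: The vertices of the grid $P_n\times P_n$ are labelled $(i,j)$, $1\le i,j\le n$ (row $i$, column $j$); $(i,j)$ and $(i',j')$ are adjacent iff $|i-i'|+|j-j'|=1$. An induced subgraph $G$ of the grid is a column continuous subgrid if whenever $(i_1,j),(i_2,j)\in V(G)$, then $(i,j)\in V(G)$ for all $i_1\le i\le i_2$. Let $M$ be a perfect matching of $G$. For $k\ge0$, an $(i,j,k)$-bracket is a set of edges of $M$ of the form $\{\{(i,j),(i,j+1)\},\{(i+1,j),(i+2,j)\},\{(i+3,j),(i+4,j)\},\dots,\{(i+2k-1,j),(i+2k,j)\},\{(i+2k+1,j),(i+2k+1,j+1)\}\}$. For $k>0$, an $(i,j,k)$-skew bracket of type I is a set of edges of $M$ of the form $\{\{(i,j),(i,j+1)\},\{(i+1,j),(i+2,j)\},\{(i+3,j),(i+4,j)\},\dots,\{(i+2k-1,j),(i+2k,j)\},\{(i+2k,j+1),(i+2k,j+2)\}\}$, and an $(i,j,k)$-skew bracket of type II is a set of edges of $M$ of the form $\{\{(i,j+1),(i,j+2)\},\{(i,j),(i+1,j)\},\{(i+2,j),(i+3,j)\},\dots,\{(i+2k-2,j),(i+2k-1,j)\},\{(i+2k,j),(i+2k,j+1)\}\}$. -}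

module Defs where

open import Data.Nat using (ℕ; zero; suc; _+_; _*_; _∸_; _≤_; _<_)
open import Data.Sum using (_⊎_)
open import Data.Product using (_×_; _,_; ∃-syntax)
open import Relation.Binary.PropositionalEquality using (_≡_)

-- A vertex (i , j) : row i, column j.
Vertex : Set
Vertex = ℕ × ℕ

InGrid : ℕ → Vertex → Set
InGrid n (i , j) = (1 ≤ i × i ≤ n) × (1 ≤ j × j ≤ n)

Adj : Vertex → Vertex → Set
Adj (i , j) (i' , j') =
  ((suc i ≡ i') × (j ≡ j')) ⊎ ((i ≡ suc i') × (j ≡ j')) ⊎
  ((i ≡ i') × (suc j ≡ j')) ⊎ ((i ≡ i') × (j ≡ suc j'))

-- An induced subgraph G of P_n × P_n is given by its vertex set V ⊆ V(P_n × P_n);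
-- its edges are the grid edges with both ends in V.
IsSubgrid : ℕ → (Vertex → Set) → Set
IsSubgrid n V = ∀ v → V v → InGrid n v

ColumnContinuous : (Vertex → Set) → Set
ColumnContinuous V =
  ∀ i₁ i₂ i j → V (i₁ , j) → V (i₂ , j) → i₁ ≤ i → i ≤ i₂ → V (i , j)

-- M is a set of edges of G, represented as a symmetric relation
-- (M u v means the edge {u,v} belongs to M).
record IsPerfectMatching (V : Vertex → Set) (M : Vertex → Vertex → Set) : Set where
  field
    symm      : ∀ u v → M u v → M v u
    edgeOfG   : ∀ u v → M u v → V u × V v × Adj u v
    covers    : ∀ u → V u → ∃[ v ] M u v
    unique    : ∀ u v w → M u v → M u w → v ≡ w

Bracket : (Vertex → Vertex → Set) → ℕ → ℕ → ℕ → Set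
Bracket M i j k =
  M (i , j) (i , suc j) ×
  (∀ t → 1 ≤ t → t ≤ k → M (i + (2 * t ∸ 1) , j) (i + 2 * t , j)) ×
  M (i + (2 * k + 1) , j) (i + (2 * k + 1) , suc j)

SkewBracketI : (Vertex → Vertex → Set) → ℕ → ℕ → ℕ → Set
SkewBracketI M i j k =
  M (i , j) (i , suc j) ×
  (∀ t → 1 ≤ t → t ≤ k → M (i + (2 * t ∸ 1) , j) (i + 2 * t , j)) ×
  M (i + 2 * k , suc j) (i + 2 * k , suc (suc j))

SkewBracketII : (Vertex → Vertex → Set) → ℕ → ℕ → ℕ → Set
SkewBracketII M i j k =
  M (i , suc j) (i , suc (suc j)) ×
  (∀ t → 1 ≤ t → t ≤ k → M (i + (2 * t ∸ 2) , j) (i + (2 * t ∸ 1) , j)) ×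
  M (i + 2 * k , j) (i + 2 * k , suc j)

module Submission where

open import Defs
open import Data.Nat using (ℕ; _<_; zero; suc; _+_; _*_; _∸_; _≤_; z≤n; s≤s)
open import Data.Nat.Properties
open import Data.Nat.Tactic.RingSolver using (solve-∀)
open import Data.Product using (_×_; _,_; proj₁; proj₂; ∃-syntax)
open import Data.Sum using (_⊎_; inj₁; inj₂; [_,_]′)
open import Data.Empty using (⊥-elim)
open import Relation.Nullary using (¬_)
open import Relation.Binary.PropositionalEquality

-- Column continuity puts the whole segment of column j+1 between the two ends
-- of a skew bracket into G. Its inner vertices cannot be matched to the left,
-- where column j is already paired up, so they are matched vertically or to the
-- right. Scanning the segment from the end that is matched to the right, the
-- vertices are forced into vertical pairs until one is matched to the right,
-- which closes a bracket; if none is, the forced pairing collides with the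
-- other end of the skew bracket.

Paired : (Vertex → Vertex → Set) → ℕ → ℕ → ℕ → Set
Paired M r c l = ∀ t → t < l → M (r + 2 * t , c) (suc (r + 2 * t) , c)

2*suc∸1 : ∀ t → 2 * suc t ∸ 1 ≡ suc (2 * t)
2*suc∸1 t = +-suc t (t + 0)

2*suc∸2 : ∀ t → 2 * suc t ∸ 2 ≡ 2 * t
2*suc∸2 t = cong (_∸ 1) (+-suc t (t + 0))

+2*suc : ∀ a t → a + 2 * suc t ≡ suc (suc (a + 2 * t))
+2*suc = solve-∀

+2*suc-shift : ∀ a m l → suc (suc (a + 2 * m)) + 2 * l ≡ a + 2 * (m + suc l)
+2*suc-shift = solve-∀

odd-row-in-column : ∀ {V : Vertex → Set} {i c k l} → ColumnContinuous V →
  V (i , c) → V (i + 2 * k , c) → l < k → V (suc (i + 2 * l) , c)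
odd-row-in-column {i = i} {c} {k} {l} cc vi vk l<k = cc i (i + 2 * k) (suc (i + 2 * l)) c vi vk
  (≤-trans (m≤m+n i (2 * l)) (n≤1+n _))
  (begin
    suc (i + 2 * l)        ≤⟨ n≤1+n _ ⟩
    suc (suc (i + 2 * l))  ≡⟨ sym (+2*suc i l) ⟩
    i + 2 * suc l          ≤⟨ +-monoʳ-≤ i (*-monoʳ-≤ 2 l<k) ⟩
    i + 2 * k              ∎)
  where open ≤-Reasoning

module _ {M : Vertex → Vertex → Set} where

  private
    transport : ∀ {c r r′ s s′} → r ≡ r′ → s ≡ s′ → M (r , c) (s , c) → M (r′ , c) (s′ , c)
    transport {c} = subst₂ (λ x y → M (x , c) (y , c))

  Paired-head : ∀ {p c l} → Paired M p c (suc l) → M (p , c) (suc p , c)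
  Paired-head {p} ps = transport (+-identityʳ p) (cong suc (+-identityʳ p)) (ps 0 (s≤s z≤n))

  Paired-cons : ∀ {p c l} → M (p , c) (suc p , c) → Paired M (suc (suc p)) c l → Paired M p c (suc l)
  Paired-cons {p} m ps zero _ =
    transport (sym (+-identityʳ p)) (cong suc (sym (+-identityʳ p))) m
  Paired-cons {p} m ps (suc t) (s≤s t<l) =
    transport (sym (+2*suc p t)) (cong suc (sym (+2*suc p t))) (ps t t<l)

  Paired-snoc : ∀ {p c l} → Paired M p c l → M (p + 2 * l , c) (suc (p + 2 * l) , c) →
    Paired M p c (suc l)
  Paired-snoc ps m t t<1+l with m<1+n⇒m<n∨m≡n t<1+l
  ... | inj₁ t<l  = ps t t<l
  ... | inj₂ refl = m

  Paired⇒odd-pairs : ∀ {i j k} → Paired M (suc i) j k →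
    ∀ t → 1 ≤ t → t ≤ k → M (i + (2 * t ∸ 1) , j) (i + 2 * t , j)
  Paired⇒odd-pairs {i} ps (suc t) _ t<k =
    transport (sym (trans (cong (i +_) (2*suc∸1 t)) (+-suc i (2 * t)))) (sym (+2*suc i t)) (ps t t<k)

  odd-pairs⇒Paired : ∀ {i j k} → (∀ t → 1 ≤ t → t ≤ k → M (i + (2 * t ∸ 1) , j) (i + 2 * t , j)) →
    Paired M (suc i) j k
  odd-pairs⇒Paired {i} ps t t<k =
    transport (trans (cong (i +_) (2*suc∸1 t)) (+-suc i (2 * t))) (+2*suc i t)
      (ps (suc t) (s≤s z≤n) t<k)

  even-pairs⇒Paired : ∀ {i j k} → (∀ t → 1 ≤ t → t ≤ k → M (i + (2 * t ∸ 2) , j) (i + (2 * t ∸ 1) , j)) →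
    Paired M i j k
  even-pairs⇒Paired {i} ps t t<k =
    transport (cong (i +_) (2*suc∸2 t)) (trans (cong (i +_) (2*suc∸1 t)) (+-suc i (2 * t)))
      (ps (suc t) (s≤s z≤n) t<k)

  Paired⇒Bracket : ∀ {a c l} → M (a , c) (a , suc c) → Paired M (suc a) c l →
    M (suc (a + 2 * l) , c) (suc (a + 2 * l) , suc c) → Bracket M a c l
  Paired⇒Bracket {a} {c} {l} top ps bot =
    top , Paired⇒odd-pairs ps , subst (λ r → M (r , c) (r , suc c)) (sym row) bot
    where
    row : a + (2 * l + 1) ≡ suc (a + 2 * l)
    row = trans (cong (a +_) (+-comm (2 * l) 1)) (+-suc a (2 * l))

  module _ {V : Vertex → Set} (pm : IsPerfectMatching V M) where

    open IsPerfectMatching pm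

    partner-unique : ∀ {u v w} → M u v → M u w → v ≡ w
    partner-unique = unique _ _ _

    matched-neighbour : ∀ {r c} → V (r , c) →
      M (r , c) (suc r , c) ⊎ (∃[ q ] r ≡ suc q × M (r , c) (q , c)) ⊎
      M (r , c) (r , suc c) ⊎ (∃[ d ] c ≡ suc d × M (r , c) (r , d))
    matched-neighbour vr with covers _ vr
    ... | (_ , m) with proj₂ (proj₂ (edgeOfG _ _ m))
    ... | inj₁ (refl , refl)               = inj₁ m
    ... | inj₂ (inj₁ (refl , refl))        = inj₂ (inj₁ (_ , refl , m))
    ... | inj₂ (inj₂ (inj₁ (refl , refl))) = inj₂ (inj₂ (inj₁ m))
    ... | inj₂ (inj₂ (inj₂ (refl , refl))) = inj₂ (inj₂ (inj₂ (_ , refl , m)))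

    left-blocked : ∀ {r r′ j} → M (r , j) (r′ , j) → ¬ M (r , suc j) (r , j)
    left-blocked vertical across = 1+n≢n (cong proj₂ (partner-unique (symm _ _ across) vertical))

    end-not-matched-down : ∀ {a c l} → M (a , c) (a , suc c) → Paired M (suc a) c l →
      ¬ M (a + 2 * l , c) (suc (a + 2 * l) , c)
    end-not-matched-down {a} {c} {zero} top _ down =
      1+n≢n (cong proj₁ (sym (partner-unique top down′)))
      where
      down′ : M (a , c) (suc a , c)
      down′ = subst (λ r → M (r , c) (suc r , c)) (+-identityʳ a) down
    end-not-matched-down {a} {c} {suc l} _ ps down =
      >⇒≢ (s≤s (s≤s (n≤1+n _))) (cong proj₁ (partner-unique down′ (symm _ _ (ps l ≤-refl))))
      where
      down′ : M (suc (suc (a + 2 * l)) , c) (suc (suc (suc (a + 2 * l))) , c)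
      down′ = subst (λ r → M (r , c) (suc r , c)) (+2*suc a l) down

    start-not-matched-up : ∀ {q c l} → Paired M (suc q) c l →
      M (suc q + 2 * l , c) (suc q + 2 * l , suc c) → ¬ M (suc q , c) (q , c)
    start-not-matched-up {q} {c} {zero} _ bot up =
      1+n≢n (cong proj₂ (sym (partner-unique up bot′)))
      where
      bot′ : M (suc q , c) (suc q , suc c)
      bot′ = subst (λ r → M (r , c) (r , suc c)) (+-identityʳ (suc q)) bot
    start-not-matched-up {l = suc l} ps _ up =
      >⇒≢ (s≤s (n≤1+n _)) (cong proj₁ (partner-unique (Paired-head ps) up))

    module _ (no-bracket : ∀ i j k → ¬ Bracket M i j k) (cc : ColumnContinuous V) where

      forced-down : ∀ {a j l} → M (a , suc j) (a , suc (suc j)) → Paired M (suc a) (suc j) l →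
        V (suc (a + 2 * l) , suc j) →
        M (suc (a + 2 * l) , suc j) (suc (suc (a + 2 * l)) , suc j) ⊎
        M (suc (a + 2 * l) , suc j) (suc (a + 2 * l) , j)
      forced-down {a} {j} {l} top ps v with matched-neighbour v
      ... | inj₁ down                     = inj₁ down
      ... | inj₂ (inj₁ (_ , refl , up))   = ⊥-elim (end-not-matched-down top ps (symm _ _ up))
      ... | inj₂ (inj₂ (inj₁ right))      = ⊥-elim (no-bracket a (suc j) l (Paired⇒Bracket top ps right))
      ... | inj₂ (inj₂ (inj₂ (_ , refl , left))) = inj₂ left

      forced-up : ∀ {q j l} → Paired M (suc (suc q)) (suc j) l →
        M (suc (suc q) + 2 * l , suc j) (suc (suc q) + 2 * l , suc (suc j)) → V (suc q , suc j) →
        M (suc q , suc j) (q , suc j) ⊎ M (suc q , suc j) (suc q , j)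
      forced-up {q} {j} {l} ps bot v with matched-neighbour v
      ... | inj₁ down                     = ⊥-elim (start-not-matched-up ps bot (symm _ _ down))
      ... | inj₂ (inj₁ (_ , refl , up))   = inj₁ up
      ... | inj₂ (inj₂ (inj₁ right))      = ⊥-elim (no-bracket (suc q) (suc j) l (Paired⇒Bracket right ps bot))
      ... | inj₂ (inj₂ (inj₂ (_ , refl , left))) = inj₂ left

      no-skew-bracket-II : ∀ i j k → ¬ SkewBracketII M i j (suc k)
      no-skew-bracket-II i j k (top , middle , bot) = collision (pairs-below (suc k) ≤-refl)
        where
        column-j : Paired M i j (suc k)
        column-j = even-pairs⇒Paired middle

        pairs-below : ∀ l → l ≤ suc k → Paired M (suc i) (suc j) l
        pairs-below zero    _   = λ _ ()
        pairs-below (suc l) l<1+k =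
          [ Paired-snoc {p = suc i} above
          , (λ left → ⊥-elim (left-blocked (symm _ _ (column-j l l<1+k)) left))
          ]′ (forced-down {a = i} top above
               (odd-row-in-column cc (proj₁ (edgeOfG _ _ top)) (proj₁ (proj₂ (edgeOfG _ _ bot))) l<1+k))
          where
          above : Paired M (suc i) (suc j) l
          above = pairs-below l (<⇒≤ l<1+k)

        collision : ¬ Paired M (suc i) (suc j) (suc k)
        collision ps = 1+n≢n (cong proj₂ (partner-unique last (symm _ _ bot)))
          where
          last : M (i + 2 * suc k , suc j) (suc (i + 2 * k) , suc j)
          last = subst (λ r → M (r , suc j) (suc (i + 2 * k) , suc j)) (sym (+2*suc i k))
                   (symm _ _ (ps k ≤-refl))

      no-skew-bracket-I : ∀ i j k → ¬ SkewBracketI M i j (suc k)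
      no-skew-bracket-I i j k (top , middle , bot) = collision (pairs-above 0 (suc k) refl)
        where
        column-j : Paired M (suc i) j (suc k)
        column-j = odd-pairs⇒Paired middle

        pairs-above : ∀ m l → m + l ≡ suc k → Paired M (i + 2 * m) (suc j) l
        pairs-above m zero    _ = λ _ ()
        pairs-above m (suc l) m+l≡k =
          [ (λ up → Paired-cons (symm _ _ up) block)
          , (λ left → ⊥-elim (left-blocked (column-j m m<k) left))
          ]′ (forced-up block bot′
               (odd-row-in-column cc (proj₁ (proj₂ (edgeOfG _ _ top))) (proj₁ (edgeOfG _ _ bot)) m<k))
          where
          m<k : m < suc k
          m<k = subst (m <_) m+l≡k (m<m+n m (s≤s z≤n))

          block : Paired M (suc (suc (i + 2 * m))) (suc j) l
          block = subst (λ r → Paired M r (suc j) l) (+2*suc i m)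
                    (pairs-above (suc m) l (trans (sym (+-suc m l)) m+l≡k))

          row : suc (suc (i + 2 * m)) + 2 * l ≡ i + 2 * suc k
          row = trans (+2*suc-shift i m l) (cong (λ x → i + 2 * x) m+l≡k)

          bot′ : M (suc (suc (i + 2 * m)) + 2 * l , suc j)
                   (suc (suc (i + 2 * m)) + 2 * l , suc (suc j))
          bot′ = subst (λ r → M (r , suc j) (r , suc (suc j))) (sym row) bot

        collision : ¬ Paired M (i + 0) (suc j) (suc k)
        collision ps = 1+n≢n (cong proj₂ (partner-unique first (symm _ _ top)))
          where
          first : M (i , suc j) (suc i , suc j)
          first = subst (λ r → M (r , suc j) (suc r , suc j)) (+-identityʳ i) (Paired-head ps)

mainTheorem9 : (n : ℕ) (V : Vertex → Set) (M : Vertex → Vertex → Set) →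
    IsSubgrid n V → ColumnContinuous V → IsPerfectMatching V M →
    (∀ i j k → ¬ Bracket M i j k) →
    ∀ i j k → 0 < k → ¬ SkewBracketI M i j k × ¬ SkewBracketII M i j k
mainTheorem9 _ _ _ _ cc pm no-bracket i j (suc k) _ =
  no-skew-bracket-I pm no-bracket cc i j k , no-skew-bracket-II pm no-bracket cc i j k
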